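{- Let $G$ be a finite simple graph and $U$ a spanning subgraph of $G$. Then: (i) $U$ is a fixing subgraph of $G$ if and only if for each spanning subgraph $U_0$ of $G$ with $U_0\cong U$ there exists an isomorphism $\sigma:U\to U_0$ which extends to an automorphism of $G$; (ii) $U$ is a strong fixing subgraph of $G$ if and only if for each spanning subgraph $U_0$ of $G$ with $U_0\cong U$ and each isomorphism $\sigma:U_0\to U$, $\sigma$ extends to an automorphism of $G$.
   Context: All graphs are finite and simple; a spanning subgraph of $G$ has vertex set $V(G)$ and edge set contained in $E(G)$. $A(H)$ denotes the automorphism group of $H$; for spanning subgraphs of $G$ these are subgroups of the symmetric group on $V(G)$. $s(U;G)$ is the number of spanning subgraphs of $G$ isomorphic to $U$. A spanning subgraph $U$ of $G$ is a fixing subgraph of $G$ if $s(U;G)=|A(G)|/|A(U)\cap A(G)|$, and a strong fixing subgraph of $G$ if moreover $A(U)\subseteq A(G)$ (equivalently $s(U;G)=|A(G)|/|A(U)|$). -}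

module Defs where

open import Level using (Level)
open import Data.Nat using (ℕ; zero; suc)
open import Data.Bool using (Bool; true; false) renaming (_≟_ to _≟ᵇ_)
open import Data.Fin using (Fin) renaming (_≟_ to _≟ᶠ_)
open import Data.Fin.Properties using (all?; any?)
open import Data.Vec using (Vec; []; _∷_; lookup)
open import Data.List using (List; []; _∷_; map; concatMap; length; filter; allFin)
open import Data.Product using (Σ; ∃; _×_; _,_; proj₁; proj₂)
open import Relation.Nullary using (Dec; yes; no; map′)
open import Relation.Nullary.Decidable using (_×-dec_; _→-dec_)
open import Relation.Unary using (Pred; Decidable)
open import Relation.Binary.PropositionalEquality using (_≡_; refl)

Adj : ℕ → Set
Adj n = Vec (Vec Bool n) n

adj : ∀ {n} → Adj n → Fin n → Fin n → Bool
adj A i j = lookup (lookup A i) j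

IsSimple : ∀ {n} → Adj n → Set
IsSimple A = (∀ i j → adj A i j ≡ adj A j i) × (∀ i → adj A i i ≡ false)

Spanning : ∀ {n} → Adj n → Adj n → Set
Spanning G U = IsSimple U × (∀ i j → adj U i j ≡ true → adj G i j ≡ true)

PermV : ℕ → Set
PermV n = Vec (Fin n) n

IsPerm : ∀ {n} → PermV n → Set
IsPerm σ = ∀ i j → lookup σ i ≡ lookup σ j → i ≡ j

IsIso : ∀ {n} → Adj n → Adj n → PermV n → Set
IsIso H K σ = IsPerm σ × (∀ i j → adj K (lookup σ i) (lookup σ j) ≡ adj H i j)

IsAut : ∀ {n} → Adj n → PermV n → Set
IsAut H σ = IsIso H H σ

Iso : ∀ {n} → Adj n → Adj n → Set
Iso H K = Σ (PermV _) (IsIso H K)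

isSimple? : ∀ {n} (A : Adj n) → Dec (IsSimple A)
isSimple? A = all? (λ i → all? (λ j → adj A i j ≟ᵇ adj A j i))
              ×-dec all? (λ i → adj A i i ≟ᵇ false)

spanning? : ∀ {n} (G U : Adj n) → Dec (Spanning G U)
spanning? G U = isSimple? U
  ×-dec all? (λ i → all? (λ j → (adj U i j ≟ᵇ true) →-dec (adj G i j ≟ᵇ true)))

isPerm? : ∀ {n} (σ : PermV n) → Dec (IsPerm σ)
isPerm? σ = all? (λ i → all? (λ j → (lookup σ i ≟ᶠ lookup σ j) →-dec (i ≟ᶠ j)))

isIso? : ∀ {n} (H K : Adj n) (σ : PermV n) → Dec (IsIso H K σ)
isIso? H K σ = isPerm? σ
  ×-dec all? (λ i → all? (λ j → adj K (lookup σ i) (lookup σ j) ≟ᵇ adj H i j))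

isAut? : ∀ {n} (H : Adj n) (σ : PermV n) → Dec (IsAut H σ)
isAut? H = isIso? H H

∃Vec? : ∀ {p : Level} {m} k {P : Pred (Vec (Fin m) k) p} → Decidable P → Dec (∃ P)
∃Vec? zero P? with P? []
... | yes p = yes ([] , p)
... | no ¬p = no λ { ([] , p) → ¬p p }
∃Vec? (suc k) {P} P? =
  map′ (λ { (x , v , p) → (x ∷ v) , p })
       (λ { ((x ∷ v) , p) → x , v , p })
       (any? (λ x → ∃Vec? k (λ v → P? (x ∷ v))))

iso? : ∀ {n} (H K : Adj n) → Dec (Iso H K)
iso? {n} H K = ∃Vec? n (isIso? H K)

vecsOver : ∀ {A : Set} → List A → (k : ℕ) → List (Vec A k)
vecsOver xs zero    = [] ∷ []
vecsOver xs (suc k) = concatMap (λ x → map (x ∷_) (vecsOver xs k)) xs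

allMaps : (n : ℕ) → List (PermV n)
allMaps n = vecsOver (allFin n) n

allAdj : (n : ℕ) → List (Adj n)
allAdj n = vecsOver (vecsOver (true ∷ false ∷ []) n) n

autCount : ∀ {n} → Adj n → ℕ
autCount {n} H = length (filter (isAut? H) (allMaps n))

autCapCount : ∀ {n} → Adj n → Adj n → ℕ
autCapCount {n} U G = length (filter (λ σ → isAut? U σ ×-dec isAut? G σ) (allMaps n))

s : ∀ {n} → Adj n → Adj n → ℕ
s {n} U G = length (filter (λ M → spanning? G M ×-dec iso? U M) (allAdj n))

-- Fixing subgraphs.  s(U;G) = |A(G)| / |A(U) ∩ A(G)| is stated in the
-- division-free form s(U;G) · |A(U) ∩ A(G)| = |A(G)|
-- (the divisor is always ≥ 1, as it contains the identity).

open import Data.Nat using (_*_)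

Fixing : ∀ {n} → Adj n → Adj n → Set
Fixing G U = s U G * autCapCount U G ≡ autCount G

StrongFixing : ∀ {n} → Adj n → Adj n → Set
StrongFixing G U = Fixing G U × (∀ σ → IsAut U σ → IsAut G σ)

-- The automorphisms of G carrying U onto a given copy M (a spanning subgraph of G isomorphic
-- to U) form, when there are any, a coset of A(U) ∩ A(G).  Sorting A(G) by the image of U
-- gives |A(G)| = Σ_M t(M) with each t(M) equal to 0 or |A(U) ∩ A(G)|, so the bound
-- |A(G)| ≤ s(U;G)·|A(U) ∩ A(G)| is attained exactly when every copy is reached: this is (i).
-- For (ii), when A(U) ⊆ A(G) an arbitrary isomorphism U₀ → U differs from one that extends
-- by an automorphism of U; conversely, taking U₀ = U yields A(U) ⊆ A(G).
module Submission where

open import Defs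
open import Data.Nat using (ℕ; zero; suc; _+_; _*_; _≤_; z≤n; s≤s)
open import Data.Nat.Properties
  using (≤-antisym; ≤-reflexive; ≤-trans; +-mono-≤; +-monoʳ-≤; +-cancelʳ-≤; +-cancelˡ-≡; +-suc; 1+n≰n)
open import Data.Nat.ListAction using (sum)
open import Data.Bool using (true; false)
open import Data.Fin using (Fin; punchOut) renaming (_≟_ to _≟ᶠ_)
open import Data.Fin.Properties using (any?; punchOut-injective; injective⇒≤)
open import Data.Vec using (Vec; []; _∷_; lookup; tabulate)
open import Data.Vec.Properties using (lookup∘tabulate; tabulate∘lookup; tabulate-cong; ∷-injective)
open import Data.List using (List; []; _∷_; map; length; filter; _++_; concatMap; cartesianProductWith)
open import Data.List.Properties using (map-cong-local; filter-≐; filter-some; filter-none; length-++-sucʳ)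
open import Data.List.Membership.Propositional using (_∈_; lose)
open import Data.List.Membership.Propositional.Properties
  using (∈-++⁻; ∈-++⁺ˡ; ∈-++⁺ʳ; ∈-∃++; ∈-filter⁺; ∈-filter⁻; ∈-cartesianProductWith⁺; ∈-allFin)
open import Data.List.Relation.Unary.Any using (here; there)
open import Data.List.Relation.Unary.All using (All; []; _∷_)
import Data.List.Relation.Unary.All as All
open import Data.List.Relation.Unary.AllPairs using ([]; _∷_)
open import Data.List.Relation.Unary.Unique.Propositional using (Unique)
import Data.List.Relation.Unary.Unique.Propositional.Properties as Unique
open import Data.Product using (Σ; ∃; _×_; _,_; proj₁; proj₂)
open import Data.Sum using (inj₁; inj₂)
open import Function using (_∘_)
open import Function.Bundles using (_⇔_; mk⇔; module Equivalence)
open import Level using (0ℓ)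
open import Relation.Nullary using (¬_; yes; no; contradiction)
open import Relation.Unary using (Pred; Decidable; ∁; _∩_; _≐_)
open import Relation.Unary.Properties using (_∩?_; ∁?)
open import Relation.Binary.PropositionalEquality
open ≡-Reasoning

module _ {A B : Set} where

  ∈-++-remove : ∀ {z w : B} xs ys → z ∈ xs ++ w ∷ ys → z ≢ w → z ∈ xs ++ ys
  ∈-++-remove xs ys z∈ z≢w with ∈-++⁻ xs z∈
  ... | inj₁ p = ∈-++⁺ˡ p
  ... | inj₂ (here z≡w) = contradiction z≡w z≢w
  ... | inj₂ (there p) = ∈-++⁺ʳ xs p

  length-≤-injection : (f : A → B) (xs : List A) (ys : List B) → Unique xs →
    (∀ {x} → x ∈ xs → f x ∈ ys) →
    (∀ {x y} → x ∈ xs → y ∈ xs → f x ≡ f y → x ≡ y) →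
    length xs ≤ length ys
  length-≤-injection f [] ys _ _ _ = z≤n
  length-≤-injection f (x ∷ xs) ys (x∉xs ∷ u) into inj
    with zs , ws , refl ← ∈-∃++ (into (here refl)) =
    subst (suc (length xs) ≤_) (sym (length-++-sucʳ zs (f x) ws))
      (s≤s (length-≤-injection f xs (zs ++ ws) u
        (λ y∈ → ∈-++-remove zs ws (into (there y∈))
          (λ fy≡fx → All.lookup x∉xs y∈ (inj (here refl) (there y∈) (sym fy≡fx))))
        (λ p q → inj (there p) (there q))))

module _ {A : Set} where

  length-filter-≤-injection : (xs : List A) → Unique xs → (∀ x → x ∈ xs) →
    {P Q : Pred A 0ℓ} (P? : Decidable P) (Q? : Decidable Q) (f : A → A) →
    (∀ x → P x → Q (f x)) →
    (∀ {x y} → P x → P y → f x ≡ f y → x ≡ y) →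
    length (filter P? xs) ≤ length (filter Q? xs)
  length-filter-≤-injection xs u complete {P} P? Q? f PQ inj =
    length-≤-injection f (filter P? xs) (filter Q? xs) (Unique.filter⁺ P? u)
      (λ x∈ → ∈-filter⁺ Q? (complete _) (PQ _ (P-of x∈)))
      (λ x∈ y∈ → inj (P-of x∈) (P-of y∈))
    where
    P-of : ∀ {x} → x ∈ filter P? xs → P x
    P-of = proj₂ ∘ ∈-filter⁻ P? {xs = xs}

  length-filter-split : {P Q : Pred A 0ℓ} (P? : Decidable P) (Q? : Decidable Q) (xs : List A) →
    length (filter P? xs) ≡ length (filter (P? ∩? Q?) xs) + length (filter (P? ∩? ∁? Q?) xs)
  length-filter-split P? Q? [] = refl
  length-filter-split P? Q? (x ∷ xs) with P? x | Q? x
  ... | yes _ | yes _ = cong suc (length-filter-split P? Q? xs)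
  ... | yes _ | no _ = trans (cong suc (length-filter-split P? Q? xs)) (sym (+-suc _ _))
  ... | no _ | _ = length-filter-split P? Q? xs

  length-≤-if-nonempty-≡ : ∀ {c} (xs : List A) → (∀ {x} → x ∈ xs → length xs ≡ c) → length xs ≤ c
  length-≤-if-nonempty-≡ [] _ = z≤n
  length-≤-if-nonempty-≡ (x ∷ xs) len≡c = ≤-reflexive (len≡c (here refl))

  nonempty⇒∈ : ∀ {xs : List A} → 1 ≤ length xs → ∃ (_∈ xs)
  nonempty⇒∈ {x ∷ _} _ = x , here refl

module _ {A B : Set} where

  length-filter-fibres : {P : Pred A 0ℓ} (P? : Decidable P)
    {R : A → B → Set} (R? : ∀ m → Decidable (λ x → R x m))
    (ms : List B) → Unique ms →
    (∀ x → P x → ∃ λ m → m ∈ ms × R x m) →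
    (∀ {x m m′} → R x m → R x m′ → m ≡ m′) →
    (xs : List A) →
    length (filter P? xs) ≡ sum (map (λ m → length (filter (P? ∩? R? m) xs)) ms)
  length-filter-fibres {P} P? R? [] _ fibre _ xs =
    cong length (filter-none P? {xs} (All.tabulate (λ _ → nowhere)))
    where
    nowhere : ∀ {x} → ¬ P x
    nowhere {x} p with fibre x p
    ... | _ , () , _
  length-filter-fibres {P} P? {R} R? (m ∷ ms) (m∉ms ∷ u) fibre functional xs = begin
    length (filter P? xs)
      ≡⟨ length-filter-split P? (R? m) xs ⟩
    length (filter (P? ∩? R? m) xs) + length (filter (P? ∩? ∁? (R? m)) xs)
      ≡⟨ cong (_ +_) (length-filter-fibres (P? ∩? ∁? (R? m)) R? ms u fibre′ functional xs) ⟩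
    length (filter (P? ∩? R? m) xs) + sum (map (λ m′ → length (filter ((P? ∩? ∁? (R? m)) ∩? R? m′) xs)) ms)
      ≡⟨ cong (λ ns → _ + sum ns) (map-cong-local (All.tabulate (λ m′∈ → cong length (filter-≐ _ _ (outside-m m′∈) xs)))) ⟩
    length (filter (P? ∩? R? m) xs) + sum (map (λ m′ → length (filter (P? ∩? R? m′) xs)) ms)
      ∎
    where
    fibre′ : ∀ x → (P ∩ ∁ (λ y → R y m)) x → ∃ λ m′ → m′ ∈ ms × R x m′
    fibre′ x (p , ¬r) with fibre x p
    ... | _ , here refl , r = contradiction r ¬r
    ... | m′ , there m′∈ , r = m′ , m′∈ , r
    outside-m : ∀ {m′} → m′ ∈ ms →
      ((P ∩ ∁ (λ y → R y m)) ∩ (λ y → R y m′)) ≐ (P ∩ (λ y → R y m′))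
    outside-m m′∈ = (λ ((p , _) , r′) → p , r′)
                  , (λ (p , r′) → (p , λ r → All.lookup m∉ms m′∈ (functional r r′)) , r′)

module _ {B : Set} (f : B → ℕ) {c : ℕ} where

  sum-map-≤ : (∀ m → f m ≤ c) → ∀ ms → sum (map f ms) ≤ length ms * c
  sum-map-≤ f≤c [] = z≤n
  sum-map-≤ f≤c (m ∷ ms) = +-mono-≤ (f≤c m) (sum-map-≤ f≤c ms)

  sum-map-const : ∀ {ms} → All (λ m → f m ≡ c) ms → sum (map f ms) ≡ length ms * c
  sum-map-const [] = refl
  sum-map-const (fm≡c ∷ fms≡c) = cong₂ _+_ fm≡c (sum-map-const fms≡c)

  sum-map-tight : (∀ m → f m ≤ c) → ∀ ms → sum (map f ms) ≡ length ms * c →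
    All (λ m → f m ≡ c) ms
  sum-map-tight f≤c [] _ = []
  sum-map-tight f≤c (m ∷ ms) eq = fm≡c ∷ sum-map-tight f≤c ms (+-cancelˡ-≡ c _ _ tail-eq)
    where
    fm≡c : f m ≡ c
    fm≡c = ≤-antisym (f≤c m) (+-cancelʳ-≤ (sum (map f ms)) c (f m)
      (≤-trans (+-monoʳ-≤ c (sum-map-≤ f≤c ms)) (≤-reflexive (sym eq))))
    tail-eq : c + sum (map f ms) ≡ c + length ms * c
    tail-eq = trans (cong (_+ _) (sym fm≡c)) eq

module _ {A : Set} where

  vecsOver-suc : (xs : List A) (k : ℕ) →
    vecsOver xs (suc k) ≡ cartesianProductWith _∷_ xs (vecsOver xs k)
  vecsOver-suc xs k = go xs
    where
    go : ∀ ys → concatMap (λ y → map (y ∷_) (vecsOver xs k)) ys ≡ cartesianProductWith _∷_ ys (vecsOver xs k)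
    go [] = refl
    go (y ∷ ys) = cong (map (y ∷_) (vecsOver xs k) ++_) (go ys)

  Unique-vecsOver : ∀ {xs : List A} → Unique xs → ∀ k → Unique (vecsOver xs k)
  Unique-vecsOver u zero = [] ∷ []
  Unique-vecsOver {xs} u (suc k) rewrite vecsOver-suc xs k =
    Unique.cartesianProductWith⁺ _∷_ ∷-injective u (Unique-vecsOver u k)

  ∈-vecsOver : ∀ {xs : List A} → (∀ x → x ∈ xs) → ∀ {k} (v : Vec A k) → v ∈ vecsOver xs k
  ∈-vecsOver complete [] = here refl
  ∈-vecsOver {xs} complete {suc k} (x ∷ v) rewrite vecsOver-suc xs k =
    ∈-cartesianProductWith⁺ _∷_ (complete x) (∈-vecsOver complete v)

  Vec-ext : ∀ {k} (u v : Vec A k) → (∀ i → lookup u i ≡ lookup v i) → u ≡ v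
  Vec-ext u v u≗v = begin
    u                   ≡⟨ tabulate∘lookup u ⟨
    tabulate (lookup u) ≡⟨ tabulate-cong u≗v ⟩
    tabulate (lookup v) ≡⟨ tabulate∘lookup v ⟩
    v                   ∎

∈-booleans : ∀ b → b ∈ true ∷ false ∷ []
∈-booleans true = here refl
∈-booleans false = there (here refl)

module _ {n : ℕ} where

  Unique-allMaps : Unique (allMaps n)
  Unique-allMaps = Unique-vecsOver (Unique.allFin⁺ n) n

  ∈-allMaps : ∀ σ → σ ∈ allMaps n
  ∈-allMaps = ∈-vecsOver ∈-allFin

  Unique-allAdj : Unique (allAdj n)
  Unique-allAdj = Unique-vecsOver (Unique-vecsOver (((λ ()) ∷ []) ∷ [] ∷ []) n) n

  ∈-allAdj : ∀ M → M ∈ allAdj n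
  ∈-allAdj = ∈-vecsOver (∈-vecsOver ∈-booleans)

  adj-ext : (M M′ : Adj n) → (∀ a b → adj M a b ≡ adj M′ a b) → M ≡ M′
  adj-ext M M′ M≗M′ = Vec-ext M M′ (λ a → Vec-ext (lookup M a) (lookup M′ a) (M≗M′ a))

IsPerm-surjective : ∀ {n} (σ : PermV n) → IsPerm σ → ∀ i → ∃ λ j → lookup σ j ≡ i
IsPerm-surjective {suc m} σ σ-injective i with any? (λ j → lookup σ j ≟ᶠ i)
... | yes hit = hit
... | no miss = contradiction (injective⇒≤ punched-injective) 1+n≰n
  where
  missed : ∀ j → i ≢ lookup σ j
  missed j i≡σj = miss (j , sym i≡σj)
  punched : Fin (suc m) → Fin m
  punched j = punchOut (missed j)
  punched-injective : ∀ {j k} → punched j ≡ punched k → j ≡ k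
  punched-injective {j} {k} eq = σ-injective j k (punchOut-injective (missed j) (missed k) eq)

∀-on-image₂ : ∀ {n} (σ : PermV n) → IsPerm σ → {P : Fin n → Fin n → Set} →
  (∀ i j → P (lookup σ i) (lookup σ j)) → ∀ a b → P a b
∀-on-image₂ σ p P-image a b with IsPerm-surjective σ p a | IsPerm-surjective σ p b
... | i , refl | j , refl = P-image i j

module _ {n : ℕ} where

  inverse : (σ : PermV n) → IsPerm σ → PermV n
  inverse σ p = tabulate (proj₁ ∘ IsPerm-surjective σ p)

  lookup-inverseʳ : (σ : PermV n) (p : IsPerm σ) → ∀ a → lookup σ (lookup (inverse σ p) a) ≡ a
  lookup-inverseʳ σ p a rewrite lookup∘tabulate (proj₁ ∘ IsPerm-surjective σ p) a =
    proj₂ (IsPerm-surjective σ p a)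

  lookup-inverseˡ : (σ : PermV n) (p : IsPerm σ) → ∀ i → lookup (inverse σ p) (lookup σ i) ≡ i
  lookup-inverseˡ σ p i = p _ _ (lookup-inverseʳ σ p (lookup σ i))

  IsPerm-inverse : (σ : PermV n) (p : IsPerm σ) → IsPerm (inverse σ p)
  IsPerm-inverse σ p a b eq = begin
    a                                 ≡⟨ lookup-inverseʳ σ p a ⟨
    lookup σ (lookup (inverse σ p) a) ≡⟨ cong (lookup σ) eq ⟩
    lookup σ (lookup (inverse σ p) b) ≡⟨ lookup-inverseʳ σ p b ⟩
    b                                 ∎

  IsIso-inverse : ∀ {H K : Adj n} {σ} (p : IsPerm σ) → IsIso H K σ → IsIso K H (inverse σ p)
  IsIso-inverse {H} {K} {σ} p (_ , e) = IsPerm-inverse σ p , λ a b → begin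
    adj H (lookup σ⁻¹ a) (lookup σ⁻¹ b)                       ≡⟨ e _ _ ⟨
    adj K (lookup σ (lookup σ⁻¹ a)) (lookup σ (lookup σ⁻¹ b)) ≡⟨ cong₂ (adj K) (lookup-inverseʳ σ p a) (lookup-inverseʳ σ p b) ⟩
    adj K a b                                                 ∎
    where σ⁻¹ = inverse σ p

  IsIso-of-inverse : ∀ {H K : Adj n} {σ} (p : IsPerm σ) → IsIso K H (inverse σ p) → IsIso H K σ
  IsIso-of-inverse {H} {K} {σ} p (_ , e) = p , λ i j → begin
    adj K (lookup σ i) (lookup σ j)                           ≡⟨ e _ _ ⟨
    adj H (lookup σ⁻¹ (lookup σ i)) (lookup σ⁻¹ (lookup σ j)) ≡⟨ cong₂ (adj H) (lookup-inverseˡ σ p i) (lookup-inverseˡ σ p j) ⟩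
    adj H i j                                                 ∎
    where σ⁻¹ = inverse σ p

  infixr 9 _∘ᵖ_
  _∘ᵖ_ : PermV n → PermV n → PermV n
  τ ∘ᵖ α = tabulate (lookup τ ∘ lookup α)

  lookup-∘ᵖ : ∀ τ α i → lookup (τ ∘ᵖ α) i ≡ lookup τ (lookup α i)
  lookup-∘ᵖ τ α = lookup∘tabulate (lookup τ ∘ lookup α)

  IsIso-∘ : ∀ {H K L : Adj n} {α β} → IsIso H K α → IsIso K L β → IsIso H L (β ∘ᵖ α)
  IsIso-∘ {H} {K} {L} {α} {β} (pα , eα) (pβ , eβ) =
    (λ i j eq → pα i j (pβ _ _ (trans (sym (lookup-∘ᵖ β α i)) (trans eq (lookup-∘ᵖ β α j))))) ,
    λ i j → trans (cong₂ (adj L) (lookup-∘ᵖ β α i) (lookup-∘ᵖ β α j)) (trans (eβ _ _) (eα i j))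

  IsIso-cancelʳ : ∀ {H J K : Adj n} {α β} → IsIso H J α → IsIso H K (β ∘ᵖ α) → IsPerm β → IsIso J K β
  IsIso-cancelʳ {H} {J} {K} {α} {β} (pα , eα) (_ , eβα) pβ = pβ , ∀-on-image₂ α pα λ i j → begin
    adj K (lookup β (lookup α i)) (lookup β (lookup α j)) ≡⟨ cong₂ (adj K) (lookup-∘ᵖ β α i) (lookup-∘ᵖ β α j) ⟨
    adj K (lookup (β ∘ᵖ α) i) (lookup (β ∘ᵖ α) j)         ≡⟨ eβα i j ⟩
    adj H i j                                             ≡⟨ eα i j ⟨
    adj J (lookup α i) (lookup α j)                       ∎

  ∘ᵖ-cancelˡ : ∀ τ → IsPerm τ → ∀ α β → τ ∘ᵖ α ≡ τ ∘ᵖ β → α ≡ β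
  ∘ᵖ-cancelˡ τ p α β eq = Vec-ext α β (λ i → p _ _ (begin
    lookup τ (lookup α i) ≡⟨ lookup-∘ᵖ τ α i ⟨
    lookup (τ ∘ᵖ α) i     ≡⟨ cong (λ v → lookup v i) eq ⟩
    lookup (τ ∘ᵖ β) i     ≡⟨ lookup-∘ᵖ τ β i ⟩
    lookup τ (lookup β i) ∎))

  idᵖ : PermV n
  idᵖ = tabulate (λ i → i)

  IsAut-id : ∀ (H : Adj n) → IsAut H idᵖ
  IsAut-id H =
    (λ i j eq → trans (sym (lookup-id i)) (trans eq (lookup-id j))) ,
    (λ i j → cong₂ (adj H) (lookup-id i) (lookup-id j))
    where
    lookup-id : ∀ i → lookup idᵖ i ≡ i
    lookup-id = lookup∘tabulate (λ i → i)

  image : (σ : PermV n) → IsPerm σ → Adj n → Adj n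
  image σ p U = tabulate (λ a → tabulate (λ b → adj U (lookup σ⁻¹ a) (lookup σ⁻¹ b)))
    where σ⁻¹ = inverse σ p

  adj-image : ∀ σ p U a b →
    adj (image σ p U) a b ≡ adj U (lookup (inverse σ p) a) (lookup (inverse σ p) b)
  adj-image σ p U a b = begin
    lookup (lookup (image σ p U) a) b                               ≡⟨ cong (λ row → lookup row b) (lookup∘tabulate _ a) ⟩
    lookup (tabulate (λ b → adj U (lookup σ⁻¹ a) (lookup σ⁻¹ b))) b ≡⟨ lookup∘tabulate _ b ⟩
    adj U (lookup σ⁻¹ a) (lookup σ⁻¹ b)                             ∎
    where σ⁻¹ = inverse σ p

  IsIso-image : ∀ σ p U → IsIso U (image σ p U) σ
  IsIso-image σ p U = p , λ i j →
    trans (adj-image σ p U _ _) (cong₂ (adj U) (lookup-inverseˡ σ p i) (lookup-inverseˡ σ p j))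

  IsIso-target-unique : ∀ {U M M′ : Adj n} {σ} → IsIso U M σ → IsIso U M′ σ → M ≡ M′
  IsIso-target-unique {U} {M} {M′} {σ} (p , e) (_ , e′) =
    adj-ext M M′ (∀-on-image₂ σ p λ i j → trans (e i j) (sym (e′ i j)))

  Spanning-image : ∀ {G U : Adj n} {σ} (p : IsPerm σ) → IsAut G σ → Spanning G U → Spanning G (image σ p U)
  Spanning-image {G} {U} {σ} p (_ , e) ((U-sym , U-loopless) , U⊆G) =
    ( (λ a b → trans (adj-image σ p U a b) (trans (U-sym _ _) (sym (adj-image σ p U b a))))
    , (λ a → trans (adj-image σ p U a a) (U-loopless _)) )
    , λ a b edge → begin
      adj G a b                                                 ≡⟨ cong₂ (adj G) (lookup-inverseʳ σ p a) (lookup-inverseʳ σ p b) ⟨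
      adj G (lookup σ (lookup σ⁻¹ a)) (lookup σ (lookup σ⁻¹ b)) ≡⟨ e _ _ ⟩
      adj G (lookup σ⁻¹ a) (lookup σ⁻¹ b)                       ≡⟨ U⊆G _ _ (trans (sym (adj-image σ p U a b)) edge) ⟩
      true                                                      ∎
    where σ⁻¹ = inverse σ p

module Orbit {n : ℕ} (G U : Adj n) where

  copies : List (Adj n)
  copies = filter (spanning? G ∩? iso? U) (allAdj n)

  transporters : Adj n → List (PermV n)
  transporters M = filter (isAut? G ∩? isIso? U M) (allMaps n)

  autCount≡sum-transporters : Spanning G U → autCount G ≡ sum (map (length ∘ transporters) copies)
  autCount≡sum-transporters spU =
    length-filter-fibres (isAut? G) (isIso? U) copies (Unique.filter⁺ _ Unique-allAdj)
      fibre (λ {σ} {M} {M′} → IsIso-target-unique {U = U} {M} {M′} {σ}) (allMaps n)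
    where
    fibre : ∀ σ → IsAut G σ → ∃ λ M → M ∈ copies × IsIso U M σ
    fibre σ aut@(p , _) =
      image σ p U ,
      ∈-filter⁺ (spanning? G ∩? iso? U) (∈-allAdj _) (Spanning-image {G = G} {U} p aut spU , σ , IsIso-image σ p U) ,
      IsIso-image σ p U

  length-transporters : ∀ M τ → IsAut G τ → IsIso U M τ → length (transporters M) ≡ autCapCount U G
  length-transporters M τ autτ@(pτ , _) isoτ = ≤-antisym
    (length-filter-≤-injection (allMaps n) Unique-allMaps ∈-allMaps
      (isAut? G ∩? isIso? U M) (isAut? U ∩? isAut? G) (τ⁻¹ ∘ᵖ_) to-stabiliser
      (λ {σ} {σ′} _ _ → ∘ᵖ-cancelˡ τ⁻¹ (IsPerm-inverse τ pτ) σ σ′))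
    (length-filter-≤-injection (allMaps n) Unique-allMaps ∈-allMaps
      (isAut? U ∩? isAut? G) (isAut? G ∩? isIso? U M) (τ ∘ᵖ_) from-stabiliser
      (λ {α} {α′} _ _ → ∘ᵖ-cancelˡ τ pτ α α′))
    where
    τ⁻¹ = inverse τ pτ
    to-stabiliser : ∀ σ → IsAut G σ × IsIso U M σ → IsAut U (τ⁻¹ ∘ᵖ σ) × IsAut G (τ⁻¹ ∘ᵖ σ)
    to-stabiliser σ (autσ , isoσ) =
      IsIso-∘ {H = U} {M} {U} {σ} {τ⁻¹} isoσ (IsIso-inverse {H = U} {M} pτ isoτ) ,
      IsIso-∘ {H = G} {G} {G} {σ} {τ⁻¹} autσ (IsIso-inverse {H = G} {G} pτ autτ)
    from-stabiliser : ∀ α → IsAut U α × IsAut G α → IsAut G (τ ∘ᵖ α) × IsIso U M (τ ∘ᵖ α)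
    from-stabiliser α (autU , autG) =
      IsIso-∘ {H = G} {G} {G} {α} {τ} autG autτ , IsIso-∘ {H = U} {U} {M} {α} {τ} autU isoτ

  length-transporters-≤ : ∀ M → length (transporters M) ≤ autCapCount U G
  length-transporters-≤ M = length-≤-if-nonempty-≡ (transporters M) λ {σ} σ∈ →
    let _ , autσ , isoσ = ∈-filter⁻ (isAut? G ∩? isIso? U M) {xs = allMaps n} σ∈
    in length-transporters M σ autσ isoσ

  autCapCount-positive : 1 ≤ autCapCount U G
  autCapCount-positive = filter-some (isAut? U ∩? isAut? G) (lose (∈-allMaps idᵖ) (IsAut-id U , IsAut-id G))

SomeIsoExtends : ∀ {n} → Adj n → Adj n → Set
SomeIsoExtends {n} G U =
  ∀ (U₀ : Adj n) → Spanning G U₀ → Iso U U₀ → Σ (PermV n) (λ σ → IsIso U U₀ σ × IsAut G σ)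

EveryIsoExtends : ∀ {n} → Adj n → Adj n → Set
EveryIsoExtends {n} G U =
  ∀ (U₀ : Adj n) → Spanning G U₀ → Iso U₀ U → ∀ (σ : PermV n) → IsIso U₀ U σ → IsAut G σ

module _ {n : ℕ} (G U : Adj n) (spU : Spanning G U) where
  open Orbit G U

  fixing⇔someIsoExtends : Fixing G U ⇔ SomeIsoExtends G U
  fixing⇔someIsoExtends = mk⇔ to from
    where
    to : Fixing G U → SomeIsoExtends G U
    to fixing U₀ spU₀ isoU₀ =
      let σ , σ∈ = nonempty⇒∈ (subst (1 ≤_) (sym tight) autCapCount-positive)
          _ , autσ , isoσ = ∈-filter⁻ (isAut? G ∩? isIso? U U₀) {xs = allMaps n} σ∈
      in σ , isoσ , autσ
      where
      tight : length (transporters U₀) ≡ autCapCount U G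
      tight = All.lookup
        (sum-map-tight (length ∘ transporters) length-transporters-≤ copies
          (trans (sym (autCount≡sum-transporters spU)) (sym fixing)))
        (∈-filter⁺ (spanning? G ∩? iso? U) (∈-allAdj U₀) (spU₀ , isoU₀))
    from : SomeIsoExtends G U → Fixing G U
    from extends = sym (trans (autCount≡sum-transporters spU)
      (sum-map-const (length ∘ transporters) (All.tabulate λ {M} M∈ →
        let _ , spM , isoM = ∈-filter⁻ (spanning? G ∩? iso? U) {xs = allAdj n} M∈
            τ , isoτ , autτ = extends M spM isoM
        in length-transporters M τ autτ isoτ)))

  strongFixing⇔everyIsoExtends : StrongFixing G U ⇔ EveryIsoExtends G U
  strongFixing⇔everyIsoExtends = mk⇔ to from
    where
    to : StrongFixing G U → EveryIsoExtends G U
    to (fixing , autU⊆autG) U₀ spU₀ (ρ , isoρ@(pρ , _)) σ isoσ@(pσ , _) =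
      let τ , isoτ , autτ = Equivalence.to fixing⇔someIsoExtends fixing U₀ spU₀
                              (inverse ρ pρ , IsIso-inverse {H = U₀} {U} pρ isoρ)
      in IsIso-cancelʳ {H = G} {G} {G} {τ} {σ} autτ
           (autU⊆autG (σ ∘ᵖ τ) (IsIso-∘ {H = U} {U₀} {U} {τ} {σ} isoτ isoσ)) pσ
    from : EveryIsoExtends G U → StrongFixing G U
    from every = Equivalence.from fixing⇔someIsoExtends extends , λ σ autU → every U spU (σ , autU) σ autU
      where
      extends : SomeIsoExtends G U
      extends U₀ spU₀ (ρ , isoρ@(pρ , _)) =
        ρ , isoρ , IsIso-of-inverse {H = G} {G} pρ (every U₀ spU₀ (ρ⁻¹ , isoρ⁻¹) ρ⁻¹ isoρ⁻¹)
        where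
        ρ⁻¹ = inverse ρ pρ
        isoρ⁻¹ = IsIso-inverse {H = U} {U₀} pρ isoρ

theorem3 : ∀ (n : ℕ) (G U : Adj n) → IsSimple G → Spanning G U →
    (Fixing G U ⇔
      (∀ (U₀ : Adj n) → Spanning G U₀ → Iso U U₀ →
        Σ (PermV n) (λ σ → IsIso U U₀ σ × IsAut G σ)))
    × (StrongFixing G U ⇔
      (∀ (U₀ : Adj n) → Spanning G U₀ → Iso U₀ U →
        ∀ (σ : PermV n) → IsIso U₀ U σ → IsAut G σ))
theorem3 n G U _ spU = fixing⇔someIsoExtends G U spU , strongFixing⇔everyIsoExtends G U spU
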